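{- Let $\mathbf{A}_0, \mathbf{A}_1, \ldots, \mathbf{A}_m$ be forests of finite rooted trees, let $d_{max} = \max_{1\le i\le m} \mathrm{depth}(\mathbf{A}_i)$, and assume $\mathrm{depth}(\mathbf{A}_0) \le d_{max}$. Let $P(\mathbf{X}) = \mathbf{A}_0 + \sum_{i=1}^{m} \mathbf{A}_i \mathbf{X}^i$. Then $P$ is injective on the semiring of forests of finite trees of depth at most $d_{max}$: for all such forests $\mathbf{X},\mathbf{Y}$, $P(\mathbf{X}) = P(\mathbf{Y})$ implies $\mathbf{X} = \mathbf{Y}$.
   Context: A forest is a finite multiset of finite rooted trees, taken up to isomorphism; the sum of forests is multiset union. The depth of a vertex is its distance to the root, the depth of a tree is the maximum depth of its vertices, and the depth of a forest is the maximum depth of its trees. The product of two rooted trees $\mathbf{t}_1,\mathbf{t}_2$ is the rooted tree whose vertices are pairs $(u,v)$ of vertices of $\mathbf{t}_1$ and $\mathbf{t}_2$ with equal depth and whose edges are $((u,u'),(v,v'))$ where $(u,v)$ is an edge (child to parent) of $\mathbf{t}_1$ and $(u',v')$ an edge of $\mathbf{t}_2$ (its depth is the minimum of the two depths); the product of forests is the multiset of all pairwise products of their trees. For each $d$, forests of depth at most $d$ form a commutative semiring under these operations with multiplicative identity the path of depth $d$. -}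

module Defs where

open import Data.Nat using (ℕ; zero; suc; _≤_; _⊔_)
open import Data.List using (List; []; _∷_; _++_; map; concatMap)
open import Data.Vec using (Vec; []; _∷_)
open import Data.Maybe using (Maybe; nothing; just)
open import Data.Unit using (⊤)
open import Data.Empty using (⊥)

-- Finite rooted trees (plane representation; isomorphism handled by _≅_ below).
data Tree : Set where
  node : List Tree → Tree

-- A forest: a finite multiset of rooted trees, represented by a list
-- (equality of forests is _≈F_ below: multiset equality up to isomorphism).
Forest : Set
Forest = List Tree

infix 4 _≅_ _≈F_
data _≅_ : Tree → Tree → Set
data _≈F_ : Forest → Forest → Set

data _≅_ where
  node : ∀ {ts us} → ts ≈F us → node ts ≅ node us

data _≈F_ where
  []  : [] ≈F []
  _∷_ : ∀ {t u ts us₁ us₂} → t ≅ u → ts ≈F (us₁ ++ us₂) →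
        (t ∷ ts) ≈F (us₁ ++ u ∷ us₂)

depthT : Tree → ℕ
depthL : List Tree → ℕ
depthT (node ts) = depthL ts
depthL [] = 0
depthL (t ∷ ts) = suc (depthT t) ⊔ depthL ts

-- Maximum on ℕ ∪ {-∞}, with nothing = -∞ (maximum over the empty set).
maxM : Maybe ℕ → Maybe ℕ → Maybe ℕ
maxM nothing  b        = b
maxM (just a) nothing  = just a
maxM (just a) (just b) = just (a ⊔ b)

infix 4 _≤M_
_≤M_ : Maybe ℕ → Maybe ℕ → Set
nothing ≤M _      = ⊤
just a  ≤M nothing = ⊥
just a  ≤M just b  = a ≤ b

depthF : Forest → Maybe ℕ
depthF [] = nothing
depthF (t ∷ ts) = maxM (just (depthT t)) (depthF ts)

dmax : ∀ {m} → Vec Forest m → Maybe ℕ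
dmax [] = nothing
dmax (A ∷ As) = maxM (depthF A) (dmax As)

-- Product of rooted trees: pairs of vertices of equal depth.
mulT : Tree → Tree → Tree
mulL : List Tree → Tree → List Tree
mulR : Tree → List Tree → List Tree
mulT (node ts) u = node (mulL ts u)
mulL [] u = []
mulL (t ∷ ts) (node us) = mulR t us ++ mulL ts (node us)
mulR t [] = []
mulR t (u ∷ us) = mulT t u ∷ mulR t us

infixl 6 _⊕_
infixl 7 _⊗_
_⊕_ : Forest → Forest → Forest
F ⊕ G = F ++ G

_⊗_ : Forest → Forest → Forest
F ⊗ G = concatMap (λ t → map (mulT t) G) F

-- powS X k = X^(k+1)
powS : Forest → ℕ → Forest
powS X zero = X
powS X (suc k) = X ⊗ powS X k

-- Σ_{i=1}^{m} A_i X^i, where the list is [A_k, …, A_m] and k = j+1.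
polyTail : ∀ {m} → ℕ → Vec Forest m → Forest → Forest
polyTail j [] X = []
polyTail j (A ∷ As) X = A ⊗ powS X j ⊕ polyTail (suc j) As X

P : ∀ {m} → Forest → Vec Forest m → Forest → Forest
P A0 As X = A0 ⊕ polyTail 0 As X

-- Let hom(S, t) count the maps from the tree S to the tree t sending the root to the root and
-- children to children, and hom(S, F) = Σ_{t ∈ F} hom(S, t).  Then hom(S, −) is additive and
-- multiplicative, so hom(S, P(X)) = hom(S, A₀) + Σᵢ hom(S, Aᵢ) hom(S, X)ⁱ, and hom(S, A) > 0 iff A
-- has a tree at least as deep as S.  If hom(S, X) < hom(S, Y), then S is no deeper than Y, hence
-- no deeper than some Aᵢ, so this polynomial has a positive non-constant coefficient and is
-- strictly increasing: hom(S, P(X)) ≠ hom(S, P(Y)).  Thus P(X) = P(Y) gives hom(S, X) = hom(S, Y)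
-- for all S, and these counts determine a forest up to isomorphism: give a tree t the coordinates
-- hom(s, children of t), so that hom(node ss, t) is the monomial ∏_{s ∈ ss} of them.  A tree of X
-- with no isomorphic copy in Y differs, by induction, in some coordinate from each tree of Y; a
-- product of squares (x_s − c)² is then positive at it and vanishes on Y, and expanding this
-- product shows that some power sum Σ_t hom(node ss, t) differs between X and Y.
module Submission where

open import Defs
open import Data.List using (List; []; _∷_; _++_; map)
open import Data.List.Relation.Unary.All as All using (All; []; _∷_)
import Data.List.Relation.Unary.First as First
open import Data.List.Relation.Unary.First.Properties using (toView)
open import Data.Maybe using (nothing; just)
open import Data.Nat using (ℕ; zero; suc; _≤_; _<_; _⊔_; z≤n; s≤s; z<s; s≤s⁻¹)
open import Data.Nat.ListAction using (sum)
open import Data.Product using (∃; _×_; _,_; proj₁; proj₂)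
open import Data.Sum as Sum using (_⊎_; inj₁; inj₂; [_,_]′)
open import Data.Unit using (tt)
open import Data.Vec as Vec using (Vec; []; _∷_)
open import Data.Vec.Relation.Unary.Any as Any using (Any; here; there)
open import Data.Vec.Relation.Unary.Any.Properties using (map⁺)
open import Function using (_∘_; id)
open import Relation.Binary.PropositionalEquality
open import Relation.Nullary using (yes; no; contradiction)

module PowerSumSeparation {A K : Set} (x : K → A → ℕ) where

  import Data.Nat as ℕ
  import Data.Nat.Properties as ℕ
  open import Data.Integer using (ℤ; +_; 0ℤ; 1ℤ; _+_; _-_; _*_; ∣_∣; -[1+_])
  open import Data.Integer.Properties
    using (_≟_; pos-+; pos-*; +-injective; +-inverseʳ; *-assoc; *-identityˡ; *-identityʳ;
           ∣i∣≡0⇒i≡0; i-j≡0⇒i≡j)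
  open import Data.Integer.Tactic.RingSolver using (solve-∀)
  open ≡-Reasoning

  monomial : List K → A → ℕ
  monomial [] a = 1
  monomial (k ∷ ks) a = x k a ℕ.* monomial ks a

  powerSum : List K → List A → ℕ
  powerSum ks L = sum (map (monomial ks) L)

  Apart : A → A → Set
  Apart a b = ∃ λ k → x k a ≢ x k b

  ∑ : (A → ℤ) → List A → ℤ
  ∑ f [] = 0ℤ
  ∑ f (a ∷ L) = f a + ∑ f L

  ∑-cong : ∀ {f g} → (∀ a → f a ≡ g a) → ∀ L → ∑ f L ≡ ∑ g L
  ∑-cong f≗g [] = refl
  ∑-cong f≗g (a ∷ L) = cong₂ _+_ (f≗g a) (∑-cong f≗g L)

  ∑-pos : ∀ f L → ∑ (λ a → + f a) L ≡ + sum (map f L)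
  ∑-pos f [] = refl
  ∑-pos f (a ∷ L) = trans (cong (_+_ (+ f a)) (∑-pos f L)) (sym (pos-+ (f a) _))

  ∑-linear : ∀ c f g L → ∑ (λ a → f a - c * g a) L ≡ ∑ f L - c * ∑ g L
  ∑-linear c f g [] = zero-linear c
    where
    zero-linear : ∀ c → 0ℤ ≡ 0ℤ - c * 0ℤ
    zero-linear = solve-∀
  ∑-linear c f g (a ∷ L) =
    trans (cong (_+_ (f a - c * g a)) (∑-linear c f g L)) (regroup (f a) (g a) c (∑ f L) (∑ g L))
    where
    regroup : ∀ u v c U V → u - c * v + (U - c * V) ≡ u + U - c * (v + V)
    regroup = solve-∀

  moment : (A → ℤ) → List K → List A → ℤ
  moment g ks = ∑ (λ a → g a * + monomial ks a)

  record Separated (g : A → ℤ) (L₁ L₂ : List A) : Set where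
    constructor separated
    field
      exponents : List K
      moments-differ : moment g exponents L₁ ≢ moment g exponents L₂

  separated-cong : ∀ {g h L₁ L₂} → (∀ a → g a ≡ h a) → Separated g L₁ L₂ → Separated h L₁ L₂
  separated-cong {g} {h} {L₁} {L₂} g≗h (separated ks ≢) =
    separated ks λ ≡h → ≢ (trans (moment-cong L₁) (trans ≡h (sym (moment-cong L₂))))
    where
    moment-cong : ∀ L → moment g ks L ≡ moment h ks L
    moment-cong = ∑-cong (λ a → cong (_* + monomial ks a) (g≗h a))

  moment-factor : ∀ g k c ks L →
    moment (λ a → g a * (+ x k a - c)) ks L ≡ moment g (k ∷ ks) L - c * moment g ks L
  moment-factor g k c ks L = trans (∑-cong pointwise L) (∑-linear c _ _ L)
    where
    expand : ∀ g x c m → g * (x - c) * m ≡ g * (x * m) - c * (g * m)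
    expand = solve-∀
    pointwise : ∀ a → g a * (+ x k a - c) * + monomial ks a
                    ≡ g a * + monomial (k ∷ ks) a - c * (g a * + monomial ks a)
    pointwise a = trans (expand (g a) (+ x k a) c (+ monomial ks a))
      (cong (λ m → g a * m - c * (g a * + monomial ks a)) (sym (pos-* (x k a) (monomial ks a))))

  separated-factor : ∀ {g L₁ L₂} k c → Separated (λ a → g a * (+ x k a - c)) L₁ L₂ →
                     Separated g L₁ L₂
  separated-factor {g} {L₁} {L₂} k c (separated ks ≢)
    with moment g (k ∷ ks) L₁ ≟ moment g (k ∷ ks) L₂
  ... | no ≢′ = separated (k ∷ ks) ≢′
  ... | yes ≡′ = separated ks λ ≡″ → ≢ (begin
    moment (λ a → g a * (+ x k a - c)) ks L₁  ≡⟨ moment-factor g k c ks L₁ ⟩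
    moment g (k ∷ ks) L₁ - c * moment g ks L₁  ≡⟨ cong₂ (λ p q → p - c * q) ≡′ ≡″ ⟩
    moment g (k ∷ ks) L₂ - c * moment g ks L₂  ≡⟨ moment-factor g k c ks L₂ ⟨
    moment (λ a → g a * (+ x k a - c)) ks L₂  ∎)

  gap : K → ℕ → A → ℤ
  gap k c a = + x k a - + c

  -- Squares keep the weights nonnegative, so their sum over a ∷ F cannot cancel.
  vanishing : List (K × ℕ) → A → ℕ
  vanishing [] a = 1
  vanishing ((k , c) ∷ W) a = vanishing W a ℕ.* (∣ gap k c a ∣ ℕ.* ∣ gap k c a ∣)

  i*i≡∣i∣*∣i∣ : ∀ i → i * i ≡ + (∣ i ∣ ℕ.* ∣ i ∣)
  i*i≡∣i∣*∣i∣ (+ n) = sym (pos-* n n)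
  i*i≡∣i∣*∣i∣ -[1+ n ] = refl

  vanishing-∷ : ∀ k c W a → + vanishing ((k , c) ∷ W) a ≡ + vanishing W a * gap k c a * gap k c a
  vanishing-∷ k c W a = begin
    + (v ℕ.* (∣ d ∣ ℕ.* ∣ d ∣))  ≡⟨ pos-* v _ ⟩
    + v * + (∣ d ∣ ℕ.* ∣ d ∣)    ≡⟨ cong (+ v *_) (i*i≡∣i∣*∣i∣ d) ⟨
    + v * (d * d)                ≡⟨ *-assoc (+ v) d d ⟨
    + v * d * d                  ∎
    where
    v : ℕ
    v = vanishing W a
    d : ℤ
    d = gap k c a

  separated-vanishing : ∀ W {L₁ L₂} → Separated (λ a → + vanishing W a) L₁ L₂ →
                        Separated (λ _ → 1ℤ) L₁ L₂
  separated-vanishing [] = id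
  separated-vanishing ((k , c) ∷ W) =
    separated-vanishing W ∘ separated-factor k (+ c) ∘ separated-factor k (+ c)
      ∘ separated-cong (vanishing-∷ k c W)

  separating-factors : ∀ {a G} → All (Apart a) G →
                       ∃ λ W → 0 < vanishing W a × All (λ b → vanishing W b ≡ 0) G
  separating-factors [] = [] , z<s , []
  separating-factors {a} {b ∷ G} ((k , xa≢xb) ∷ apart) with separating-factors apart
  ... | W , positive , zeros =
    (k , x k b) ∷ W ,
    ℕ.*-mono-< positive (ℕ.*-mono-< gap>0 gap>0) ,
    vanishes-at-b ∷ All.map (cong (ℕ._* _)) zeros
    where
    gap>0 : 0 < ∣ gap k (x k b) a ∣
    gap>0 = ℕ.n≢0⇒n>0 (xa≢xb ∘ +-injective ∘ i-j≡0⇒i≡j _ _ ∘ ∣i∣≡0⇒i≡0)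
    vanishes-at-b : vanishing ((k , x k b) ∷ W) b ≡ 0
    vanishes-at-b = trans (cong (λ d → vanishing W b ℕ.* (∣ d ∣ ℕ.* ∣ d ∣)) (+-inverseʳ (+ x k b)))
                          (ℕ.*-zeroʳ (vanishing W b))

  moment-[] : ∀ f L → moment (λ a → + f a) [] L ≡ + sum (map f L)
  moment-[] f L = trans (∑-cong (λ a → *-identityʳ (+ f a)) L) (∑-pos f L)

  moment-1 : ∀ ks L → moment (λ _ → 1ℤ) ks L ≡ + powerSum ks L
  moment-1 ks L = trans (∑-cong (λ a → *-identityˡ (+ monomial ks a)) L) (∑-pos (monomial ks) L)

  sum-map-≡0 : ∀ {f : A → ℕ} {L} → All (λ a → f a ≡ 0) L → sum (map f L) ≡ 0
  sum-map-≡0 [] = refl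
  sum-map-≡0 (fa≡0 ∷ zeros) = cong₂ ℕ._+_ fa≡0 (sum-map-≡0 zeros)

  vanishing-separates : ∀ {W a} F {G} → 0 < vanishing W a → All (λ b → vanishing W b ≡ 0) G →
                        Separated (λ b → + vanishing W b) (a ∷ F) G
  vanishing-separates {W} {a} F {G} positive zeros = separated [] λ eq →
    ℕ.<⇒≢ (ℕ.<-≤-trans positive (ℕ.m≤m+n _ _)) (sym (+-injective (begin
      + sum (map (vanishing W) (a ∷ F))          ≡⟨ moment-[] (vanishing W) (a ∷ F) ⟨
      moment (λ b → + vanishing W b) [] (a ∷ F)  ≡⟨ eq ⟩
      moment (λ b → + vanishing W b) [] G        ≡⟨ moment-[] (vanishing W) G ⟩
      + sum (map (vanishing W) G)                ≡⟨ cong +_ (sum-map-≡0 zeros) ⟩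
      + 0                                        ∎)))

  powerSum-separation : ∀ {a} F {G} → All (Apart a) G → ∃ λ ks → powerSum ks (a ∷ F) ≢ powerSum ks G
  powerSum-separation {a} F {G} apart with separating-factors apart
  ... | W , positive , zeros with separated-vanishing W (vanishing-separates {W} F positive zeros)
  ...   | separated ks ≢ =
    ks , λ eq → ≢ (trans (moment-1 ks (a ∷ F)) (trans (cong +_ eq) (sym (moment-1 ks G))))

-- Opened only here: the module above uses the integer operators of the same names.
open import Data.Nat using (_+_; _*_; _^_; >-nonZero)
open import Data.Nat.Properties
open import Algebra.Properties.CommutativeSemigroup +-commutativeSemigroup using (x∙yz≈y∙xz)
open import Algebra.Properties.CommutativeSemigroup *-commutativeSemigroup using (interchange)
open import Relation.Binary.Definitions using (tri<; tri≈; tri>)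
open ≡-Reasoning

m+n>0⇒m>0⊎n>0 : ∀ m {n} → 0 < m + n → 0 < m ⊎ 0 < n
m+n>0⇒m>0⊎n>0 zero n>0 = inj₂ n>0
m+n>0⇒m>0⊎n>0 (suc m) _ = inj₁ z<s

m*n>0⇒m>0×n>0 : ∀ m {n} → 0 < m * n → 0 < m × 0 < n
m*n>0⇒m>0×n>0 (suc m) {suc n} _ = z<s , z<s
m*n>0⇒m>0×n>0 (suc m) {zero} m*0>0 = contradiction (sym (*-zeroʳ m)) (<⇒≢ m*0>0)

m≤n⊔o⇒m≤n⊎m≤o : ∀ {m} n o → m ≤ n ⊔ o → m ≤ n ⊎ m ≤ o
m≤n⊔o⇒m≤n⊎m≤o {m} n o m≤n⊔o = Sum.map along along (⊔-sel n o)
  where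
  along : ∀ {p} → n ⊔ o ≡ p → m ≤ p
  along eq = subst (m ≤_) eq m≤n⊔o

≤M-trans : ∀ {p q r} → p ≤M q → q ≤M r → p ≤M r
≤M-trans {nothing} _ _ = tt
≤M-trans {just a} {just b} {just c} = ≤-trans
≤M-trans {just a} {just b} {nothing} _ ()

≤M-maxMˡ : ∀ {d} p q → just d ≤M p → just d ≤M maxM p q
≤M-maxMˡ (just a) nothing d≤a = d≤a
≤M-maxMˡ (just a) (just b) d≤a = ≤-trans d≤a (m≤m⊔n a b)

≤M-maxMʳ : ∀ {d} p q → just d ≤M q → just d ≤M maxM p q
≤M-maxMʳ nothing q d≤q = d≤q
≤M-maxMʳ (just a) (just b) d≤b = ≤-trans d≤b (m≤n⊔m a b)

≤M-maxM⁻ : ∀ {d} p q → just d ≤M maxM p q → just d ≤M p ⊎ just d ≤M q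
≤M-maxM⁻ nothing q d≤q = inj₂ d≤q
≤M-maxM⁻ (just a) nothing d≤a = inj₁ d≤a
≤M-maxM⁻ (just a) (just b) d≤a⊔b = m≤n⊔o⇒m≤n⊎m≤o a b d≤a⊔b

evalTail : ∀ {m} → ℕ → Vec ℕ m → ℕ → ℕ
evalTail j [] x = 0
evalTail j (c ∷ cs) x = c * x ^ suc j + evalTail (suc j) cs x

evalTail-monoʳ-≤ : ∀ j {m} (cs : Vec ℕ m) {x y} → x ≤ y → evalTail j cs x ≤ evalTail j cs y
evalTail-monoʳ-≤ j [] x≤y = z≤n
evalTail-monoʳ-≤ j (c ∷ cs) x≤y =
  +-mono-≤ (*-monoʳ-≤ c (^-monoˡ-≤ (suc j) x≤y)) (evalTail-monoʳ-≤ (suc j) cs x≤y)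

evalTail-monoʳ-< : ∀ j {m} {cs : Vec ℕ m} {x y} → Any (0 <_) cs → x < y →
                   evalTail j cs x < evalTail j cs y
evalTail-monoʳ-< j {cs = c ∷ cs} (here c>0) x<y =
  +-mono-<-≤ (*-monoʳ-< c {{>-nonZero c>0}} (^-monoˡ-< (suc j) x<y))
             (evalTail-monoʳ-≤ (suc j) cs (<⇒≤ x<y))
evalTail-monoʳ-< j {cs = c ∷ cs} (there positive) x<y =
  +-mono-≤-< (*-monoʳ-≤ c (^-monoˡ-≤ (suc j) (<⇒≤ x<y))) (evalTail-monoʳ-< (suc j) positive x<y)

-- Homomorphism counts

hom : Tree → Tree → ℕ
homNode : List Tree → Forest → ℕ
homF : Tree → Forest → ℕ
hom (node ss) (node cs) = homNode ss cs
homNode [] cs = 1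
homNode (s ∷ ss) cs = homF s cs * homNode ss cs
homF S [] = 0
homF S (t ∷ F) = hom S t + homF S F

homF-++ : ∀ S F G → homF S (F ++ G) ≡ homF S F + homF S G
homF-++ S [] G = refl
homF-++ S (t ∷ F) G = trans (cong (hom S t +_) (homF-++ S F G)) (sym (+-assoc (hom S t) _ _))

homF-insert : ∀ S F t G → homF S (F ++ t ∷ G) ≡ hom S t + homF S (F ++ G)
homF-insert S [] t G = refl
homF-insert S (u ∷ F) t G =
  trans (cong (hom S u +_) (homF-insert S F t G)) (x∙yz≈y∙xz (hom S u) (hom S t) _)

hom-resp-≅ : ∀ S {t u} → t ≅ u → hom S t ≡ hom S u
homNode-resp-≈F : ∀ ss {F G} → F ≈F G → homNode ss F ≡ homNode ss G
homF-resp-≈F : ∀ S {F G} → F ≈F G → homF S F ≡ homF S G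
hom-resp-≅ (node ss) (node F≈G) = homNode-resp-≈F ss F≈G
homNode-resp-≈F [] F≈G = refl
homNode-resp-≈F (s ∷ ss) F≈G = cong₂ _*_ (homF-resp-≈F s F≈G) (homNode-resp-≈F ss F≈G)
homF-resp-≈F S [] = refl
homF-resp-≈F S (_∷_ {u = u} {us₁ = us₁} {us₂ = us₂} t≅u F≈G) =
  trans (cong₂ _+_ (hom-resp-≅ S t≅u) (homF-resp-≈F S F≈G)) (sym (homF-insert S us₁ u us₂))

mulR≡map : ∀ t G → mulR t G ≡ map (mulT t) G
mulR≡map t [] = refl
mulR≡map t (u ∷ G) = cong (mulT t u ∷_) (mulR≡map t G)

mulL≡⊗ : ∀ F G → mulL F (node G) ≡ F ⊗ G
mulL≡⊗ [] G = refl
mulL≡⊗ (t ∷ F) G = cong₂ _++_ (mulR≡map t G) (mulL≡⊗ F G)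

hom-mulT : ∀ S t u → hom S (mulT t u) ≡ hom S t * hom S u
homNode-⊗ : ∀ ss F G → homNode ss (F ⊗ G) ≡ homNode ss F * homNode ss G
homF-⊗ : ∀ S F G → homF S (F ⊗ G) ≡ homF S F * homF S G
homF-map-mulT : ∀ S t G → homF S (map (mulT t) G) ≡ hom S t * homF S G
hom-mulT (node ss) (node F) (node G) = trans (cong (homNode ss) (mulL≡⊗ F G)) (homNode-⊗ ss F G)
homNode-⊗ [] F G = refl
homNode-⊗ (s ∷ ss) F G =
  trans (cong₂ _*_ (homF-⊗ s F G) (homNode-⊗ ss F G)) (interchange (homF s F) _ _ _)
homF-⊗ S [] G = refl
homF-⊗ S (t ∷ F) G = begin
  homF S (map (mulT t) G ++ F ⊗ G)             ≡⟨ homF-++ S (map (mulT t) G) (F ⊗ G) ⟩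
  homF S (map (mulT t) G) + homF S (F ⊗ G)     ≡⟨ cong₂ _+_ (homF-map-mulT S t G) (homF-⊗ S F G) ⟩
  hom S t * homF S G + homF S F * homF S G     ≡⟨ *-distribʳ-+ (homF S G) (hom S t) _ ⟨
  (hom S t + homF S F) * homF S G              ∎
homF-map-mulT S t [] = sym (*-zeroʳ (hom S t))
homF-map-mulT S t (u ∷ G) =
  trans (cong₂ _+_ (hom-mulT S t u) (homF-map-mulT S t G)) (sym (*-distribˡ-+ (hom S t) _ _))

homF-powS : ∀ S X k → homF S (powS X k) ≡ homF S X ^ suc k
homF-powS S X zero = sym (*-identityʳ (homF S X))
homF-powS S X (suc k) = trans (homF-⊗ S X (powS X k)) (cong (homF S X *_) (homF-powS S X k))

homF-polyTail : ∀ S j {m} (As : Vec Forest m) X →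
                homF S (polyTail j As X) ≡ evalTail j (Vec.map (homF S) As) (homF S X)
homF-polyTail S j [] X = refl
homF-polyTail S j (A ∷ As) X = begin
  homF S (A ⊗ powS X j ++ polyTail (suc j) As X)          ≡⟨ homF-++ S (A ⊗ powS X j) _ ⟩
  homF S (A ⊗ powS X j) + homF S (polyTail (suc j) As X)
    ≡⟨ cong₂ _+_ leading (homF-polyTail S (suc j) As X) ⟩
  evalTail j (Vec.map (homF S) (A ∷ As)) (homF S X)       ∎
  where
  leading : homF S (A ⊗ powS X j) ≡ homF S A * homF S X ^ suc j
  leading = trans (homF-⊗ S A (powS X j)) (cong (homF S A *_) (homF-powS S X j))

-- Positivity of homomorphism counts and depth

hom-pos⇒depth≤ : ∀ S t → 0 < hom S t → depthT S ≤ depthT t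
homNode-pos⇒depth≤ : ∀ ss F → 0 < homNode ss F → depthL ss ≤ depthL F
homF-pos⇒depth< : ∀ s F → 0 < homF s F → depthT s < depthL F
hom-pos⇒depth≤ (node ss) (node F) = homNode-pos⇒depth≤ ss F
homNode-pos⇒depth≤ [] F _ = z≤n
homNode-pos⇒depth≤ (s ∷ ss) F positive =
  ⊔-lub (homF-pos⇒depth< s F (proj₁ factors)) (homNode-pos⇒depth≤ ss F (proj₂ factors))
  where
  factors : 0 < homF s F × 0 < homNode ss F
  factors = m*n>0⇒m>0×n>0 (homF s F) positive
homF-pos⇒depth< s [] ()
homF-pos⇒depth< s (t ∷ F) positive with m+n>0⇒m>0⊎n>0 (hom s t) positive
... | inj₁ into-t = ≤-trans (s≤s (hom-pos⇒depth≤ s t into-t)) (m≤m⊔n _ (depthL F))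
... | inj₂ into-F = ≤-trans (homF-pos⇒depth< s F into-F) (m≤n⊔m _ _)

depth≤⇒hom-pos : ∀ S t → depthT S ≤ depthT t → 0 < hom S t
depth≤⇒homNode-pos : ∀ ss F → depthL ss ≤ depthL F → 0 < homNode ss F
depth<⇒homF-pos : ∀ s F → depthT s < depthL F → 0 < homF s F
depth≤⇒hom-pos (node ss) (node F) = depth≤⇒homNode-pos ss F
depth≤⇒homNode-pos [] F _ = z<s
depth≤⇒homNode-pos (s ∷ ss) F ≤F =
  *-mono-< (depth<⇒homF-pos s F (m⊔n≤o⇒m≤o _ (depthL ss) ≤F))
           (depth≤⇒homNode-pos ss F (m⊔n≤o⇒n≤o _ (depthL ss) ≤F))
depth<⇒homF-pos s (t ∷ F) <tF with m≤n⊔o⇒m≤n⊎m≤o (suc (depthT t)) (depthL F) <tF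
... | inj₁ <t = <-≤-trans (depth≤⇒hom-pos s t (s≤s⁻¹ <t)) (m≤m+n _ _)
... | inj₂ <F = <-≤-trans (depth<⇒homF-pos s F <F) (m≤n+m _ _)

≤M-dmax⁻ : ∀ {d m} (As : Vec Forest m) → just d ≤M dmax As → Any (λ A → just d ≤M depthF A) As
≤M-dmax⁻ (A ∷ As) d≤ = [ here , there ∘ ≤M-dmax⁻ As ]′ (≤M-maxM⁻ (depthF A) (dmax As) d≤)

homF-pos⇒depth≤M : ∀ S F → 0 < homF S F → just (depthT S) ≤M depthF F
homF-pos⇒depth≤M S (t ∷ F) positive with m+n>0⇒m>0⊎n>0 (hom S t) positive
... | inj₁ into-t = ≤M-maxMˡ (just (depthT t)) (depthF F) (hom-pos⇒depth≤ S t into-t)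
... | inj₂ into-F = ≤M-maxMʳ (just (depthT t)) (depthF F) (homF-pos⇒depth≤M S F into-F)

depth≤M⇒homF-pos : ∀ S F → just (depthT S) ≤M depthF F → 0 < homF S F
depth≤M⇒homF-pos S (t ∷ F) ≤F with ≤M-maxM⁻ (just (depthT t)) (depthF F) ≤F
... | inj₁ ≤t = <-≤-trans (depth≤⇒hom-pos S t ≤t) (m≤m+n _ _)
... | inj₂ ≤F′ = <-≤-trans (depth≤M⇒homF-pos S F ≤F′) (m≤n+m _ _)

-- Forests are determined by their homomorphism counts

children : Tree → Forest
children (node F) = F

open PowerSumSeparation (λ s t → homF s (children t))
  using (Apart; monomial; powerSum; powerSum-separation)

homNode≡monomial : ∀ ss F → homNode ss F ≡ monomial ss (node F)
homNode≡monomial [] F = refl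
homNode≡monomial (s ∷ ss) F = cong (homF s F *_) (homNode≡monomial ss F)

homF-node≡powerSum : ∀ ss G → homF (node ss) G ≡ powerSum ss G
homF-node≡powerSum ss [] = refl
homF-node≡powerSum ss (node F ∷ G) = cong₂ _+_ (homNode≡monomial ss F) (homF-node≡powerSum ss G)

Distinguished : Forest → Forest → Set
Distinguished F G = ∃ λ S → homF S F ≢ homF S G

apart-or-≅ : ∀ {F} → (∀ G → F ≈F G ⊎ Distinguished F G) → ∀ u → Apart (node F) u ⊎ node F ≅ u
apart-or-≅ ≈F-or-distinguished-F (node G) = Sum.swap (Sum.map₁ node (≈F-or-distinguished-F G))

apart-distinguished : ∀ {a} F {G} → All (Apart a) G → Distinguished (a ∷ F) G
apart-distinguished {a} F {G} apart with powerSum-separation F apart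
... | ss , ≢ = node ss , λ eq →
  ≢ (trans (sym (homF-node≡powerSum ss (a ∷ F))) (trans eq (homF-node≡powerSum ss G)))

homF-cancel : ∀ S {t u} F G₁ G₂ → t ≅ u → homF S (t ∷ F) ≡ homF S (G₁ ++ u ∷ G₂) →
              homF S F ≡ homF S (G₁ ++ G₂)
homF-cancel S {t} {u} F G₁ G₂ t≅u eq = +-cancelˡ-≡ (hom S t) _ _ (begin
  hom S t + homF S F            ≡⟨ eq ⟩
  homF S (G₁ ++ u ∷ G₂)         ≡⟨ homF-insert S G₁ u G₂ ⟩
  hom S u + homF S (G₁ ++ G₂)   ≡⟨ cong (_+ homF S (G₁ ++ G₂)) (hom-resp-≅ S t≅u) ⟨
  hom S t + homF S (G₁ ++ G₂)   ∎)

≈F-or-distinguished : ∀ F G → F ≈F G ⊎ Distinguished F G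
≈F-or-distinguished [] [] = inj₁ []
≈F-or-distinguished [] (node _ ∷ G) = inj₂ (node [] , λ ())
≈F-or-distinguished (node cs ∷ F) G with First.first (apart-or-≅ (≈F-or-distinguished cs)) G
... | inj₂ apart = inj₂ (apart-distinguished F apart)
... | inj₁ match with toView match
...   | First._++_∷_ {G₁} _ t≅u G₂ =
  Sum.map (t≅u ∷_) (λ (S , ≢) → S , ≢ ∘ homF-cancel S F G₁ G₂ t≅u) (≈F-or-distinguished F (G₁ ++ G₂))

homF-≡⇒≈F : ∀ F G → (∀ S → homF S F ≡ homF S G) → F ≈F G
homF-≡⇒≈F F G same = [ id , (λ (S , ≢) → contradiction (same S) ≢) ]′ (≈F-or-distinguished F G)

homF-polyTail-< : ∀ {m} (As : Vec Forest m) S {X Y} → depthF Y ≤M dmax As → homF S X < homF S Y →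
                  homF S (polyTail 0 As X) < homF S (polyTail 0 As Y)
homF-polyTail-< As S {X} {Y} Y≤dmax hX<hY =
  subst₂ _<_ (sym (homF-polyTail S 0 As X)) (sym (homF-polyTail S 0 As Y))
    (evalTail-monoʳ-< 0 (map⁺ positive-coefficient) hX<hY)
  where
  S≤dmax : just (depthT S) ≤M dmax As
  S≤dmax = ≤M-trans (homF-pos⇒depth≤M S Y (m<n⇒0<n hX<hY)) Y≤dmax
  positive-coefficient : Any (λ A → 0 < homF S A) As
  positive-coefficient = Any.map (λ {A} → depth≤M⇒homF-pos S A) (≤M-dmax⁻ As S≤dmax)

homF-polyTail-injective : ∀ {m} (As : Vec Forest m) {X Y} →
                          depthF X ≤M dmax As → depthF Y ≤M dmax As → ∀ S →
                          homF S (polyTail 0 As X) ≡ homF S (polyTail 0 As Y) → homF S X ≡ homF S Y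
homF-polyTail-injective As {X} {Y} X≤dmax Y≤dmax S eq with <-cmp (homF S X) (homF S Y)
... | tri< lt _ _ = contradiction eq (<⇒≢ (homF-polyTail-< As S Y≤dmax lt))
... | tri≈ _ e _ = e
... | tri> _ _ gt = contradiction (sym eq) (<⇒≢ (homF-polyTail-< As S X≤dmax gt))

homF-P-injective : ∀ {m} A0 (As : Vec Forest m) {X Y} →
                   depthF X ≤M dmax As → depthF Y ≤M dmax As → ∀ S →
                   homF S (P A0 As X) ≡ homF S (P A0 As Y) → homF S X ≡ homF S Y
homF-P-injective A0 As X≤dmax Y≤dmax S eq =
  homF-polyTail-injective As X≤dmax Y≤dmax S
    (+-cancelˡ-≡ (homF S A0) _ _ (trans (sym (homF-++ S A0 _)) (trans eq (homF-++ S A0 _))))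

proposition1 : ∀ {m} (A0 : Forest) (As : Vec Forest m) →
               depthF A0 ≤M dmax As →
               (X Y : Forest) → depthF X ≤M dmax As → depthF Y ≤M dmax As →
               P A0 As X ≈F P A0 As Y → X ≈F Y
proposition1 A0 As _ X Y X≤dmax Y≤dmax PX≈PY =
  homF-≡⇒≈F X Y (λ S → homF-P-injective A0 As X≤dmax Y≤dmax S (homF-resp-≈F S PX≈PY))
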